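{- Let $T$ be a tree with at least two vertices. Then there exists a non-zero $(0,1)$-vector in the row space of the adjacency matrix $A(T)$ over $\mathbb{R}$ which does not occur as a row of $A(T)$.
   Context: The adjacency matrix $A(T)=(a_{ij})$ has $a_{ij}=1$ if $v_i$ is adjacent to $v_j$ and $0$ otherwise; the row space is over the real numbers. -}

module Defs where

open import Data.Nat using (ℕ; zero; suc; _≤_)
open import Data.Fin using (Fin; zero; suc)
open import Data.Bool using (Bool; true; false)
open import Data.List using (List; []; _∷_; _++_; [_]; length)
open import Data.List.Relation.Unary.Linked using (Linked)
open import Data.List.Relation.Unary.Unique.Propositional using (Unique)
open import Data.Rational using (ℚ; 0ℚ; 1ℚ; _+_; _*_)
open import Data.Product using (Σ; _×_; ∃; ∃-syntax)
open import Relation.Binary.PropositionalEquality using (_≡_)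
open import Relation.Nullary using (¬_)

record Graph (n : ℕ) : Set where
  field
    adj   : Fin n → Fin n → Bool
    sym   : ∀ i j → adj i j ≡ adj j i
    irref : ∀ i → adj i i ≡ false
open Graph public

Adjacent : ∀ {n} → Graph n → Fin n → Fin n → Set
Adjacent G i j = adj G i j ≡ true

data Walk {n : ℕ} (G : Graph n) : Fin n → Fin n → Set where
  here : ∀ {i} → Walk G i i
  step : ∀ {i j k} → Adjacent G i j → Walk G j k → Walk G i k

Connected : ∀ {n} → Graph n → Set
Connected G = ∀ i j → Walk G i j

Cycle : ∀ {n} → Graph n → Set
Cycle {n} G = Σ (Fin n) λ v → Σ (List (Fin n)) λ vs →
  (3 ≤ length (v ∷ vs)) × Unique (v ∷ vs) × Linked (Adjacent G) ((v ∷ vs) ++ [ v ])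

Acyclic : ∀ {n} → Graph n → Set
Acyclic G = ¬ Cycle G

IsTree : ∀ {n} → Graph n → Set
IsTree G = Connected G × Acyclic G

b2q : Bool → ℚ
b2q true  = 1ℚ
b2q false = 0ℚ

AdjMatrix : ∀ {n} → Graph n → Fin n → Fin n → ℚ
AdjMatrix G i j = b2q (adj G i j)

sumℚ : ∀ {n} → (Fin n → ℚ) → ℚ
sumℚ {zero}  f = 0ℚ
sumℚ {suc n} f = f zero + sumℚ (λ i → f (suc i))

InRowSpace : ∀ {n} → (Fin n → Fin n → ℚ) → (Fin n → ℚ) → Set
InRowSpace {n} M x = ∃ λ (c : Fin n → ℚ) → (∀ (j : Fin n) → sumℚ {n} (λ i → c i * M i j) ≡ x j)

-- Take an edge uw of T and the vector v = A(u) + A(w), the sum of the two rows. It is a (0,1)-vector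
-- because u and w have no common neighbour, and it is not a row A(x): v has 1s at u and w, so x would be
-- a common neighbour of u and w. Both facts hold because a tree has no triangle.
module Submission where

open import Defs hiding (sym)
open import Data.Nat using (ℕ; _≤_; zero; suc; s≤s; z≤n)
open import Data.Fin using (Fin; zero; suc)
open import Data.Bool using (Bool; true; false; _∨_)
open import Data.Bool.Properties using (∨-zeroʳ)
open import Data.Product using (_×_; ∃; ∃₂; ∃-syntax; _,_)
open import Data.List using ([]; _∷_)
open import Data.List.Relation.Unary.Linked using ([-]; _∷_)
open import Data.List.Relation.Unary.AllPairs using ([]; _∷_)
open import Data.List.Relation.Unary.All using ([]; _∷_)
open import Data.Rational using (ℚ; 0ℚ; 1ℚ; _+_; _*_)
open import Data.Rational.Properties
  using (+-0-commutativeMonoid; +-identityˡ; +-identityʳ; *-identityˡ; *-zeroˡ; *-distribʳ-+)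
open import Algebra.Bundles using (CommutativeMonoid)
open import Algebra.Properties.CommutativeSemigroup
  (CommutativeMonoid.commutativeSemigroup +-0-commutativeMonoid) using (interchange)
open import Data.Empty using (⊥; ⊥-elim)
open import Relation.Binary.PropositionalEquality
  using (_≡_; _≢_; _≗_; refl; sym; trans; cong; cong₂; module ≡-Reasoning)
open import Relation.Nullary using (¬_)

sumℚ-cong : ∀ {n} {f g : Fin n → ℚ} → f ≗ g → sumℚ f ≡ sumℚ g
sumℚ-cong {zero}  f≗g = refl
sumℚ-cong {suc n} f≗g = cong₂ _+_ (f≗g zero) (sumℚ-cong (λ i → f≗g (suc i)))

sumℚ-zero : ∀ {n} {f : Fin n → ℚ} → (∀ i → f i ≡ 0ℚ) → sumℚ f ≡ 0ℚ
sumℚ-zero {zero}  f≡0 = refl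
sumℚ-zero {suc n} f≡0 = cong₂ _+_ (f≡0 zero) (sumℚ-zero (λ i → f≡0 (suc i)))

sumℚ-distrib-+ : ∀ {n} (f g : Fin n → ℚ) → sumℚ (λ i → f i + g i) ≡ sumℚ f + sumℚ g
sumℚ-distrib-+ {zero}  f g = refl
sumℚ-distrib-+ {suc n} f g = begin
  (f zero + g zero) + sumℚ (λ i → f (suc i) + g (suc i))
    ≡⟨ cong ((f zero + g zero) +_) (sumℚ-distrib-+ (λ i → f (suc i)) (λ i → g (suc i))) ⟩
  (f zero + g zero) + (sumℚ (λ i → f (suc i)) + sumℚ (λ i → g (suc i)))
    ≡⟨ interchange (f zero) (g zero) _ _ ⟩
  (f zero + sumℚ (λ i → f (suc i))) + (g zero + sumℚ (λ i → g (suc i))) ∎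
  where open ≡-Reasoning

basis : ∀ {n} → Fin n → Fin n → ℚ
basis zero    zero    = 1ℚ
basis zero    (suc _) = 0ℚ
basis (suc _) zero    = 0ℚ
basis (suc u) (suc i) = basis u i

sumℚ-basis : ∀ {n} (u : Fin n) (f : Fin n → ℚ) → sumℚ (λ i → basis u i * f i) ≡ f u
sumℚ-basis zero f = begin
  1ℚ * f zero + sumℚ (λ i → 0ℚ * f (suc i)) ≡⟨ cong₂ _+_ (*-identityˡ (f zero)) (sumℚ-zero (λ i → *-zeroˡ (f (suc i)))) ⟩
  f zero + 0ℚ                               ≡⟨ +-identityʳ (f zero) ⟩
  f zero                                    ∎
  where open ≡-Reasoning
sumℚ-basis (suc u) f = begin
  0ℚ * f zero + sumℚ (λ i → basis u i * f (suc i)) ≡⟨ cong₂ _+_ (*-zeroˡ (f zero)) (sumℚ-basis u (λ i → f (suc i))) ⟩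
  0ℚ + f (suc u)                                   ≡⟨ +-identityˡ (f (suc u)) ⟩
  f (suc u)                                        ∎
  where open ≡-Reasoning

module _ {n : ℕ} (M : Fin n → Fin n → ℚ) where

  InRowSpace-resp : ∀ {x y} → x ≗ y → InRowSpace M x → InRowSpace M y
  InRowSpace-resp x≗y (c , Σc≡x) = c , λ j → trans (Σc≡x j) (x≗y j)

  row∈RowSpace : ∀ u → InRowSpace M (M u)
  row∈RowSpace u = basis u , λ j → sumℚ-basis u (λ i → M i j)

  InRowSpace-+ : ∀ {x y} → InRowSpace M x → InRowSpace M y → InRowSpace M (λ j → x j + y j)
  InRowSpace-+ {x} {y} (c , Σc≡x) (d , Σd≡y) = (λ i → c i + d i) , λ j → begin
    sumℚ (λ i → (c i + d i) * M i j)              ≡⟨ sumℚ-cong (λ i → *-distribʳ-+ (M i j) (c i) (d i)) ⟩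
    sumℚ (λ i → c i * M i j + d i * M i j)        ≡⟨ sumℚ-distrib-+ (λ i → c i * M i j) (λ i → d i * M i j) ⟩
    sumℚ (λ i → c i * M i j) + sumℚ (λ i → d i * M i j) ≡⟨ cong₂ _+_ (Σc≡x j) (Σd≡y j) ⟩
    x j + y j                                     ∎
    where open ≡-Reasoning

b2q-∨ : ∀ a b → (a ≡ true → b ≡ true → ⊥) → b2q (a ∨ b) ≡ b2q a + b2q b
b2q-∨ true  true  ¬both = ⊥-elim (¬both refl refl)
b2q-∨ true  false _     = refl
b2q-∨ false true  _     = refl
b2q-∨ false false _     = refl

TriangleFree : ∀ {n} → Graph n → Set
TriangleFree G = ∀ {a b c} → Adjacent G a b → Adjacent G b c → Adjacent G c a → ⊥

module _ {n : ℕ} (G : Graph n) where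

  Adjacent-sym : ∀ {a b} → Adjacent G a b → Adjacent G b a
  Adjacent-sym {a} {b} ab = trans (Graph.sym G b a) ab

  Adjacent⇒≢ : ∀ {a b} → Adjacent G a b → a ≢ b
  Adjacent⇒≢ {a} aa refl with trans (sym aa) (irref G a)
  ... | ()

  Acyclic⇒TriangleFree : Acyclic G → TriangleFree G
  Acyclic⇒TriangleFree acyclic {a} {b} {c} ab bc ca = acyclic
    ( a , b ∷ c ∷ [] , s≤s (s≤s (s≤s z≤n))
    , ((Adjacent⇒≢ ab ∷ (λ a≡c → Adjacent⇒≢ ca (sym a≡c)) ∷ []) ∷ (Adjacent⇒≢ bc ∷ []) ∷ [] ∷ [])
    , (ab ∷ bc ∷ ca ∷ [-]) )

  Walk⇒neighbour : ∀ {i j} → i ≢ j → Walk G i j → ∃ (Adjacent G i)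
  Walk⇒neighbour i≢i here         = ⊥-elim (i≢i refl)
  Walk⇒neighbour _   (step ik _) = _ , ik

  Connected⇒edge : 2 ≤ n → Connected G → ∃₂ (Adjacent G)
  Connected⇒edge (s≤s (s≤s z≤n)) connected = zero , Walk⇒neighbour (λ ()) (connected zero (suc zero))

  edgeNeighbourhood : Fin n → Fin n → Fin n → Bool
  edgeNeighbourhood u w j = adj G u j ∨ adj G w j

  module _ (triangleFree : TriangleFree G) {u w : Fin n} (uw : Adjacent G u w) where

    edgeNeighbourhood-∋ : edgeNeighbourhood u w u ≡ true
    edgeNeighbourhood-∋ = trans (cong (adj G u u ∨_) (Adjacent-sym uw)) (∨-zeroʳ (adj G u u))

    edgeNeighbourhood-∈RowSpace : InRowSpace (AdjMatrix G) (λ j → b2q (edgeNeighbourhood u w j))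
    edgeNeighbourhood-∈RowSpace =
      InRowSpace-resp (AdjMatrix G)
        (λ j → sym (b2q-∨ (adj G u j) (adj G w j) (λ uj wj → triangleFree uw wj (Adjacent-sym uj))))
        (InRowSpace-+ (AdjMatrix G) (row∈RowSpace (AdjMatrix G) u) (row∈RowSpace (AdjMatrix G) w))

    edgeNeighbourhood-notRow : ¬ (∃[ x ] (∀ j → adj G x j ≡ edgeNeighbourhood u w j))
    edgeNeighbourhood-notRow (x , row≡) = triangleFree uw (Adjacent-sym xw) xu
      where
      xu : Adjacent G x u
      xu = trans (row≡ u) edgeNeighbourhood-∋

      xw : Adjacent G x w
      xw = trans (row≡ w) (cong (_∨ adj G w w) uw)

corollary4p6 : (n : ℕ) → 2 ≤ n → (T : Graph n) → IsTree T →
    ∃ λ (v : Fin n → Bool) → ((∃[ j ] (v j ≡ true)) × InRowSpace (AdjMatrix T) (λ j → b2q (v j)) × (¬ (∃[ i ] (∀ j → adj T i j ≡ v j))))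
corollary4p6 _ 2≤n T (connected , acyclic) =
  let u , w , uw = Connected⇒edge T 2≤n connected
      triangleFree = Acyclic⇒TriangleFree T acyclic
  in  edgeNeighbourhood T u w
    , (u , edgeNeighbourhood-∋ T triangleFree uw)
    , edgeNeighbourhood-∈RowSpace T triangleFree uw
    , edgeNeighbourhood-notRow T triangleFree uw
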